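{- Let $\mathbf{h}$ be the fixed point starting with $0$ of the morphism $0\mapsto01$, $1\mapsto12$, $2\mapsto2$. Then $b^{(3)}_{\mathbf{h}}=p_{\mathbf{h}}$.
   Context: For words $u,w$, $\binom{u}{w}$ is the number of occurrences of $w$ as a scattered subword of $u$; $u\sim_3 v$ if $\binom{u}{x}=\binom{v}{x}$ for all words $x$ of length at most $3$. $b^{(3)}_{\mathbf{x}}(n)$ is the number of $\sim_3$-classes among length-$n$ factors of $\mathbf{x}$, and $p_{\mathbf{x}}(n)$ is the number of length-$n$ factors. -}

module Defs where

open import Data.Nat using (ℕ; zero; suc; _+_; _≤_; _<_)
open import Data.Fin using (Fin; zero; suc; _≟_)
open import Data.List using (List; []; _∷_; _++_; concatMap; length; take; drop; map)
open import Data.List.Membership.Propositional using (_∈_)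
open import Data.List.Relation.Unary.All using (All)
open import Data.List.Relation.Unary.Unique.Propositional using (Unique)
open import Data.List.Relation.Unary.AllPairs using (AllPairs)
open import Data.Product using (Σ; ∃; ∃-syntax; _×_; _,_)
open import Function.Bundles using (_⇔_)
open import Relation.Binary.PropositionalEquality using (_≡_)
open import Relation.Nullary using (¬_; yes; no)

Letter : Set
Letter = Fin 3

Word : Set
Word = List Letter

σ-letter : Letter → Word
σ-letter zero             = zero ∷ suc zero ∷ []
σ-letter (suc zero)       = suc zero ∷ suc (suc zero) ∷ []
σ-letter (suc (suc zero)) = suc (suc zero) ∷ []

σ : Word → Word
σ = concatMap σ-letter

σ^ : ℕ → Word → Word
σ^ zero    w = w
σ^ (suc k) w = σ (σ^ k w)

nth : Word → ℕ → Letter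
nth []       _       = zero
nth (a ∷ _)  zero    = a
nth (_ ∷ w)  (suc i) = nth w i

-- The fixed point h = lim σ^k(0) starting with 0.  Since σ^k(0) is a prefix
-- of σ^(k+1)(0) and |σ^k(0)| ≥ k+1, the i-th letter of h is the i-th letter
-- of σ^(i+1)(0).
h : ℕ → Letter
h i = nth (σ^ (suc i) (zero ∷ [])) i

prefix : (ℕ → Letter) → ℕ → Word
prefix x zero    = []
prefix x (suc n) = x 0 ∷ prefix (λ i → x (suc i)) n

factorAt : (ℕ → Letter) → ℕ → ℕ → Word
factorAt x i n = prefix (λ j → x (i + j)) n

IsFactor : (ℕ → Letter) → ℕ → Word → Set
IsFactor x n w = ∃[ i ] factorAt x i n ≡ w

-- binomial coefficient of words: number of occurrences of w as a scattered
-- subword of u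
binom : Word → Word → ℕ
binom u       []      = 1
binom []      (_ ∷ _) = 0
binom (a ∷ u) (b ∷ w) with a ≟ b
... | yes _ = binom u w + binom u (b ∷ w)
... | no  _ = binom u (b ∷ w)

_∼₃_ : Word → Word → Set
u ∼₃ v = ∀ (x : Word) → length x ≤ 3 → binom u x ≡ binom v x

FactorComplexityIs : (ℕ → Letter) → ℕ → ℕ → Set
FactorComplexityIs x n k =
  Σ (List Word) λ L → Unique L × length L ≡ k × (∀ w → w ∈ L ⇔ IsFactor x n w)

-- b^(3)_x(n) = k : the length-n factors of x fall into exactly k ∼₃-classes,
-- i.e. there is a list of k length-n factors, pairwise non-∼₃ (one per class),
-- such that every length-n factor is ∼₃ to one of them.
BinomialComplexity3Is : (ℕ → Letter) → ℕ → ℕ → Set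
BinomialComplexity3Is x n k =
  Σ (List Word) λ L →
    All (IsFactor x n) L ×
    AllPairs (λ u v → ¬ (u ∼₃ v)) L ×
    length L ≡ k ×
    (∀ w → IsFactor x n w → ∃[ u ] (u ∈ L × w ∼₃ u))

-- Apart from its prefixes (the only factors containing 0), every factor of h is a window of
-- 1 2^0 1 2^1 1 2^2 ⋯, so it is either 2^n or 2^a 1 2^k 1 2^(k+1) ⋯ 1 2^(k+m-1) 1 2^b.
-- Such factors are determined by few binomial coefficients: |u|_0 separates the prefixes and |u|_1
-- fixes m; the count of 121 ignores a and b and is strictly increasing in k once m ≥ 1; the count
-- of 21 is a (m + 1) plus a function of k and m, which fixes a; and the length fixes b.
-- Hence every ∼₃-class of factors is a singleton, and b⁽³⁾ = p.
module Submission where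

open import Defs
open import Data.Nat using (ℕ; zero; suc; _+_; _*_; _∸_; _≤_; _<_; _≤?_; _<?_; z≤n; s≤s)
open import Data.Nat.Properties
open import Data.Fin using (zero; suc)
import Data.Fin.Properties as Fin
open import Data.List
  using (List; []; _∷_; _++_; length; map; replicate; filter; cartesianProduct; upTo; deduplicate)
open import Data.List.Properties using (length-++; length-replicate; concatMap-++; ≡-dec)
open import Data.List.Membership.Propositional using (_∈_)
open import Data.List.Membership.Propositional.Properties
  using (∈-map⁺; ∈-map⁻; ∈-filter⁺; ∈-filter⁻; ∈-cartesianProduct⁺; ∈-upTo⁺; deduplicate-∈⇔)
open import Data.List.Relation.Unary.Any using (here; there)
open import Data.List.Relation.Unary.All as All using (All; []; _∷_)
open import Data.List.Relation.Unary.AllPairs using (AllPairs; []; _∷_)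
open import Data.List.Relation.Unary.Unique.Propositional using (Unique)
open import Data.List.Relation.Unary.Unique.DecPropositional.Properties using (deduplicate-!)
open import Data.Product using (∃-syntax; _×_; _,_; proj₁; proj₂)
open import Data.Sum using (_⊎_; inj₁; inj₂)
open import Data.Empty using (⊥-elim)
open import Function using (_∘_)
open import Function.Bundles using (_⇔_; mk⇔; Equivalence)
import Function.Properties.Equivalence as ⇔
open import Relation.Binary.PropositionalEquality
open import Relation.Nullary using (¬_; Dec; yes; no)
open import Relation.Binary.Definitions using (tri<; tri≈; tri>)
open import Relation.Nullary.Decidable using (True; toWitness)

pattern one = suc zero
pattern two = suc (suc zero)

[0] [1] [2] [21] [121] : Word
[0]   = zero ∷ []
[1]   = one ∷ []
[2]   = two ∷ []
[21]  = two ∷ one ∷ []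
[121] = one ∷ two ∷ one ∷ []

_≟ʷ_ : (u v : Word) → Dec (u ≡ v)
_≟ʷ_ = ≡-dec Fin._≟_

∼₃-refl : ∀ {w} → w ∼₃ w
∼₃-refl _ _ = refl

AllPairs-weaken : ∀ {A : Set} {P : A → Set} {R S : A → A → Set} {xs} →
  (∀ {x y} → P x → P y → R x y → S x y) → All P xs → AllPairs R xs → AllPairs S xs
AllPairs-weaken R⇒S []         []         = []
AllPairs-weaken R⇒S (px ∷ pxs) (rx ∷ rxs) =
  All.zipWith (λ (py , r) → R⇒S px py r) (pxs , rx) ∷ AllPairs-weaken R⇒S pxs rxs

complexities-agree : ∀ x n (L : List Word) → (∀ w → w ∈ L ⇔ IsFactor x n w) →
  (∀ {u v} → IsFactor x n u → IsFactor x n v → u ∼₃ v → u ≡ v) →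
  ∃[ k ] (FactorComplexityIs x n k × BinomialComplexity3Is x n k)
complexities-agree x n L L⇔ ∼₃⇒≡ =
  length D ,
  (D , distinct , refl , D⇔) ,
  (D , factorsD , AllPairs-weaken (λ fu fv u≢v → u≢v ∘ ∼₃⇒≡ fu fv) factorsD distinct , refl ,
    λ w fw → w , Equivalence.from (D⇔ w) fw , ∼₃-refl)
  where
  D : List Word
  D = deduplicate _≟ʷ_ L
  distinct : Unique D
  distinct = deduplicate-! _≟ʷ_ L
  D⇔ : ∀ w → w ∈ D ⇔ IsFactor x n w
  D⇔ w = ⇔.trans (⇔.sym (deduplicate-∈⇔ _≟ʷ_)) (L⇔ w)
  factorsD : All (IsFactor x n) D
  factorsD = All.tabulate (Equivalence.to (D⇔ _))

∼₃-sym : ∀ {u v} → u ∼₃ v → v ∼₃ u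
∼₃-sym u∼v x |x|≤3 = sym (u∼v x |x|≤3)

binom-∼₃ : ∀ {u v} → u ∼₃ v → ∀ x → {True (length x ≤? 3)} → binom u x ≡ binom v x
binom-∼₃ u∼v x {|x|≤3} = u∼v x (toWitness |x|≤3)

length≡sum-binom-letters : ∀ u → length u ≡ binom u [0] + binom u [1] + binom u [2]
length≡sum-binom-letters []         = refl
length≡sum-binom-letters (zero ∷ u) = cong suc (length≡sum-binom-letters u)
length≡sum-binom-letters (one ∷ u)  = trans (cong suc (length≡sum-binom-letters u))
  (sym (cong (_+ binom u [2]) (+-suc (binom u [0]) (binom u [1]))))
length≡sum-binom-letters (two ∷ u)  = trans (cong suc (length≡sum-binom-letters u))
  (sym (+-suc (binom u [0] + binom u [1]) (binom u [2])))

∼₃⇒length≡ : ∀ {u v} → u ∼₃ v → length u ≡ length v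
∼₃⇒length≡ {u} {v} u∼v = begin
  length u                                  ≡⟨ length≡sum-binom-letters u ⟩
  binom u [0] + binom u [1] + binom u [2]
    ≡⟨ cong₂ _+_ (cong₂ _+_ (binom-∼₃ u∼v [0]) (binom-∼₃ u∼v [1])) (binom-∼₃ u∼v [2]) ⟩
  binom v [0] + binom v [1] + binom v [2]   ≡⟨ length≡sum-binom-letters v ⟨
  length v                                  ∎
  where open ≡-Reasoning

length-++-cancelˡ : ∀ {A : Set} (u : List A) {v v'} →
  length (u ++ v) ≡ length (u ++ v') → length v ≡ length v'
length-++-cancelˡ u e = +-cancelˡ-≡ (length u) _ _ (trans (sym (length-++ u)) (trans e (length-++ u)))

twos : ℕ → Word
twos n = replicate n two

blocks : ℕ → ℕ → Word
blocks j zero    = []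
blocks j (suc k) = one ∷ twos j ++ blocks (suc j) k

σ-++ : ∀ u v → σ (u ++ v) ≡ σ u ++ σ v
σ-++ = concatMap-++ σ-letter

σ-twos : ∀ n → σ (twos n) ≡ twos n
σ-twos zero    = refl
σ-twos (suc n) = cong (two ∷_) (σ-twos n)

σ-blocks : ∀ j k → σ (blocks j k) ≡ blocks (suc j) k
σ-blocks j zero    = refl
σ-blocks j (suc k) = cong (λ w → one ∷ two ∷ w) (begin
  σ (twos j ++ blocks (suc j) k)          ≡⟨ σ-++ (twos j) (blocks (suc j) k) ⟩
  σ (twos j) ++ σ (blocks (suc j) k)      ≡⟨ cong₂ _++_ (σ-twos j) (σ-blocks (suc j) k) ⟩
  twos j ++ blocks (suc (suc j)) k        ∎)
  where open ≡-Reasoning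

σ^-zero : ∀ k → σ^ k (zero ∷ []) ≡ zero ∷ blocks 0 k
σ^-zero zero    = refl
σ^-zero (suc k) = trans (cong σ (σ^-zero k)) (cong (λ w → zero ∷ one ∷ w) (σ-blocks 0 k))

State : Set
State = ℕ × ℕ

-- stream (r , j) is the infinite word 2^r 1 2^j 1 2^(j+1) ⋯
stream : State → ℕ → Letter
stream (zero  , j) zero    = one
stream (suc r , j) zero    = two
stream (zero  , j) (suc i) = stream (j , suc j) i
stream (suc r , j) (suc i) = stream (r , j) i

start : State
start = (0 , 0)

step : State → State
step (zero  , j) = (j , suc j)
step (suc r , j) = (r , j)

step^ : ℕ → State → State
step^ zero    s = s
step^ (suc i) s = step^ i (step s)

stream-suc : ∀ s i → stream s (suc i) ≡ stream (step s) i
stream-suc (zero  , j) i = refl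
stream-suc (suc r , j) i = refl

stream-+ : ∀ i s k → stream s (i + k) ≡ stream (step^ i s) k
stream-+ zero    s k = refl
stream-+ (suc i) s k = trans (stream-suc s (i + k)) (stream-+ i (step s) k)

nth-twos-++-blocks : ∀ {i k} r j → i < k → nth (twos r ++ blocks j k) i ≡ stream (r , j) i
nth-twos-++-blocks {zero}  {suc k} zero    j _         = refl
nth-twos-++-blocks {suc i} {suc k} zero    j (s≤s i<k) = nth-twos-++-blocks j (suc j) i<k
nth-twos-++-blocks {zero}          (suc r) j _         = refl
nth-twos-++-blocks {suc i}         (suc r) j i<k       = nth-twos-++-blocks r j (<-trans (n<1+n i) i<k)

h-suc : ∀ i → h (suc i) ≡ stream start i
h-suc i = begin
  nth (σ^ (2 + i) (zero ∷ [])) (suc i) ≡⟨ cong (λ w → nth w (suc i)) (σ^-zero (2 + i)) ⟩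
  nth (blocks 0 (2 + i)) i             ≡⟨ nth-twos-++-blocks 0 0 (m<n+m i (s≤s z≤n)) ⟩
  stream start i                       ∎
  where open ≡-Reasoning

window : State → ℕ → Word
window s n = prefix (stream s) n

prefix-cong : ∀ {x y} n → (∀ i → x i ≡ y i) → prefix x n ≡ prefix y n
prefix-cong zero    x≗y = refl
prefix-cong (suc n) x≗y = cong₂ _∷_ (x≗y 0) (prefix-cong n (x≗y ∘ suc))

factorAt-h-suc : ∀ i n → factorAt h (suc i) n ≡ window (step^ i start) n
factorAt-h-suc i n = prefix-cong n (λ k → trans (h-suc (i + k)) (stream-+ i start k))

_↝_ : State → State → Set
s ↝ t = ∃[ i ] step^ i s ≡ t

step^-+ : ∀ i i' s → step^ (i + i') s ≡ step^ i' (step^ i s)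
step^-+ zero    i' s = refl
step^-+ (suc i) i' s = step^-+ i i' (step s)

↝-trans : ∀ {s t u} → s ↝ t → t ↝ u → s ↝ u
↝-trans {s} (i , refl) (i' , refl) = i + i' , step^-+ i i' s

step^-countdown : ∀ d r j → step^ d (d + r , j) ≡ (r , j)
step^-countdown zero    r j = refl
step^-countdown (suc d) r j = step^-countdown d r j

run↝ : ∀ {r j} → r ≤ j → (0 , j) ↝ (r , suc j)
run↝ {r} {j} r≤j = ↝-trans (1 , refl)
  (j ∸ r , subst (λ x → step^ (j ∸ r) (x , suc j) ≡ (r , suc j)) (m∸n+n≡m r≤j)
                 (step^-countdown (j ∸ r) r (suc j)))

start↝run : ∀ j → start ↝ (0 , j)
start↝run zero    = 0 , refl
start↝run (suc j) = ↝-trans (start↝run j) (run↝ z≤n)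

start↝ : ∀ {r j} → r < j → start ↝ (r , j)
start↝ {j = suc j} (s≤s r≤j) = ↝-trans (start↝run j) (run↝ r≤j)

Valid : State → Set
Valid (r , j) = (r , j) ≡ start ⊎ r < j

Valid-step : ∀ s → Valid s → Valid (step s)
Valid-step (zero  , j) _          = inj₂ (n<1+n j)
Valid-step (suc r , j) (inj₂ r<j) = inj₂ (<-trans (n<1+n r) r<j)

Valid-step^ : ∀ i s → Valid s → Valid (step^ i s)
Valid-step^ zero    s v = v
Valid-step^ (suc i) s v = Valid-step^ i (step s) (Valid-step s v)

start↝⇒Valid : ∀ {s} → start ↝ s → Valid s
start↝⇒Valid (i , refl) = Valid-step^ i start (inj₁ refl)

window-twos : ∀ {n r} j → n ≤ r → window (r , j) n ≡ twos n
window-twos {zero}          j _         = refl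
window-twos {suc n} {suc r} j (s≤s n≤r) = cong (two ∷_) (window-twos j n≤r)

window-long-run : ∀ {n} r {j j'} → n ≤ j → n ≤ j' → window (r , j) n ≡ window (r , j') n
window-long-run {zero}  r       _   _    = refl
window-long-run {suc n} (suc r) n<j n<j' = cong (two ∷_) (window-long-run r (<⇒≤ n<j) (<⇒≤ n<j'))
window-long-run {suc n} zero {j} {j'} n<j n<j' =
  cong (one ∷_) (trans (window-twos (suc j) (<⇒≤ n<j)) (sym (window-twos (suc j') (<⇒≤ n<j'))))

ascending? : ∀ s → Dec (proj₁ s < proj₂ s)
ascending? s = proj₁ s <? proj₂ s

statesBelow : ℕ → List State
statesBelow J = filter ascending? (cartesianProduct (upTo J) (upTo J))

∈-statesBelow⁺ : ∀ {r j J} → r < j → j < J → (r , j) ∈ statesBelow J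
∈-statesBelow⁺ r<j j<J =
  ∈-filter⁺ ascending? (∈-cartesianProduct⁺ (∈-upTo⁺ (<-trans r<j j<J)) (∈-upTo⁺ j<J)) r<j

∈-statesBelow⁻ : ∀ {s J} → s ∈ statesBelow J → proj₁ s < proj₂ s
∈-statesBelow⁻ {J = J} = proj₂ ∘ ∈-filter⁻ ascending? {xs = cartesianProduct (upTo J) (upTo J)}

windows : ℕ → List Word
windows n = map (λ s → window s n) (start ∷ statesBelow (2 + n))

-- Runs longer than n are indistinguishable in a window of length n, so a state (r , j) with j > n + 1
-- shows the window of (r , n + 1), or of (n , n + 1) when r > n.
Valid⇒window-∈ : ∀ n s → Valid s → window s n ∈ windows n
Valid⇒window-∈ n s (inj₁ refl) = here refl
Valid⇒window-∈ n (r , j) (inj₂ r<j) with j <? 2 + n | r ≤? n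
... | yes j<2+n | _ = there (∈-map⁺ _ (∈-statesBelow⁺ r<j j<2+n))
... | no j≮2+n | yes r≤n =
      subst (_∈ windows n) (window-long-run r (n≤1+n n) (m+n≤o⇒n≤o 2 (≮⇒≥ j≮2+n)))
      (there (∈-map⁺ _ (∈-statesBelow⁺ {J = 2 + n} (s≤s r≤n) ≤-refl)))
... | no _ | no r≰n =
      subst (_∈ windows n) (trans (window-twos (suc n) ≤-refl) (sym (window-twos j (<⇒≤ (≰⇒> r≰n)))))
      (there (∈-map⁺ _ (∈-statesBelow⁺ {r = n} {J = 2 + n} ≤-refl ≤-refl)))

factors : ℕ → List Word
factors n = prefix h n ∷ windows n

window-factor : ∀ {s} n → start ↝ s → IsFactor h n (window s n)
window-factor n (i , refl) = suc i , factorAt-h-suc i n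

∈-factors⇔ : ∀ n w → w ∈ factors n ⇔ IsFactor h n w
∈-factors⇔ n w = mk⇔ sound complete
  where
  reachable : ∀ {s} → s ∈ start ∷ statesBelow (2 + n) → start ↝ s
  reachable (here refl) = 0 , refl
  reachable (there s∈)  = start↝ (∈-statesBelow⁻ {J = 2 + n} s∈)

  sound : w ∈ factors n → IsFactor h n w
  sound (here refl) = 0 , refl
  sound (there w∈) with ∈-map⁻ _ w∈
  ... | s , s∈ , refl = window-factor n (reachable s∈)

  complete : IsFactor h n w → w ∈ factors n
  complete (zero  , refl) = here refl
  complete (suc i , refl) = there (subst (_∈ windows n) (sym (factorAt-h-suc i n))
    (Valid⇒window-∈ n _ (start↝⇒Valid (i , refl))))

binom-twos-one : ∀ a ws → binom (twos a) (one ∷ ws) ≡ 0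
binom-twos-one zero    ws = refl
binom-twos-one (suc a) ws = binom-twos-one a ws

binom-twos-++-one : ∀ a w ws → binom (twos a ++ w) (one ∷ ws) ≡ binom w (one ∷ ws)
binom-twos-++-one zero    w ws = refl
binom-twos-++-one (suc a) w ws = binom-twos-++-one a w ws

binom-twos-21 : ∀ a → binom (twos a) [21] ≡ 0
binom-twos-21 zero    = refl
binom-twos-21 (suc a) = cong₂ _+_ (binom-twos-one a []) (binom-twos-21 a)

binom-twos-++-21 : ∀ a w → binom (twos a ++ w) [21] ≡ a * binom w [1] + binom w [21]
binom-twos-++-21 zero    w = refl
binom-twos-++-21 (suc a) w = trans (cong₂ _+_ (binom-twos-++-one a w []) (binom-twos-++-21 a w))
  (sym (+-assoc (binom w [1]) _ _))

ladder : ℕ → ℕ → ℕ → Word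
ladder k zero    b = one ∷ twos b
ladder k (suc m) b = one ∷ twos k ++ ladder (suc k) m b

data Shape (r j : ℕ) : Word → Set where
  flat  : ∀ n → Shape r j (twos n)
  climb : ∀ m b → Shape r j (twos r ++ ladder j m b)

Shape-two : ∀ {r j w} → Shape r j w → Shape (suc r) j (two ∷ w)
Shape-two (flat n)    = flat (suc n)
Shape-two (climb m b) = climb m b

Shape-one : ∀ {j w} → Shape j (suc j) w → Shape 0 j (one ∷ w)
Shape-one (flat n)    = climb 0 n
Shape-one (climb m b) = climb (suc m) b

window-shape : ∀ n r j → Shape r j (window (r , j) n)
window-shape zero    r       j = flat 0
window-shape (suc n) zero    j = Shape-one (window-shape n j (suc j))
window-shape (suc n) (suc r) j = Shape-two (window-shape n r j)

ladder-ones : ∀ k m b → binom (ladder k m b) [1] ≡ suc m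
ladder-ones k zero    b = cong suc (binom-twos-one b [])
ladder-ones k (suc m) b = cong suc (trans (binom-twos-++-one k _ []) (ladder-ones (suc k) m b))

climb-ones : ∀ a k m b → binom (twos a ++ ladder k m b) [1] ≡ suc m
climb-ones a k m b = trans (binom-twos-++-one a _ []) (ladder-ones k m b)

ladder-21-suc : ∀ k m b →
  binom (ladder k (suc m) b) [21] ≡ k * suc m + binom (ladder (suc k) m b) [21]
ladder-21-suc k m b = trans (binom-twos-++-21 k (ladder (suc k) m b))
  (cong (λ o → k * o + binom (ladder (suc k) m b) [21]) (ladder-ones (suc k) m b))

ladder-121-suc : ∀ k m b → binom (ladder k (suc m) b) [121] ≡
  binom (ladder k (suc m) b) [21] + binom (ladder (suc k) m b) [121]
ladder-121-suc k m b =
  cong (binom (ladder k (suc m) b) [21] +_) (binom-twos-++-one k (ladder (suc k) m b) [21])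

ladder-21-mono : ∀ m {k k' b b'} → k ≤ k' →
  binom (ladder k m b) [21] ≤ binom (ladder k' m b') [21]
ladder-21-mono zero {b = b} {b'} _ = ≤-reflexive (trans (binom-twos-21 b) (sym (binom-twos-21 b')))
ladder-21-mono (suc m) {k} {k'} {b} {b'} k≤k' = begin
  binom (ladder k (suc m) b) [21]      ≡⟨ ladder-21-suc k m b ⟩
  k * suc m + binom (ladder (suc k) m b) [21]
    ≤⟨ +-mono-≤ (*-monoˡ-≤ (suc m) k≤k') (ladder-21-mono m (s≤s k≤k')) ⟩
  k' * suc m + binom (ladder (suc k') m b') [21]  ≡⟨ ladder-21-suc k' m b' ⟨
  binom (ladder k' (suc m) b') [21]    ∎
  where open ≤-Reasoning

ladder-21-strict : ∀ m {k k' b b'} → k < k' →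
  binom (ladder k (suc m) b) [21] < binom (ladder k' (suc m) b') [21]
ladder-21-strict m {k} {k'} {b} {b'} k<k' = begin-strict
  binom (ladder k (suc m) b) [21]      ≡⟨ ladder-21-suc k m b ⟩
  k * suc m + binom (ladder (suc k) m b) [21]
    <⟨ +-mono-<-≤ (*-monoˡ-< (suc m) k<k') (ladder-21-mono m (s≤s (<⇒≤ k<k'))) ⟩
  k' * suc m + binom (ladder (suc k') m b') [21]  ≡⟨ ladder-21-suc k' m b' ⟨
  binom (ladder k' (suc m) b') [21]    ∎
  where open ≤-Reasoning

ladder-121-mono : ∀ m {k k' b b'} → k ≤ k' →
  binom (ladder k m b) [121] ≤ binom (ladder k' m b') [121]
ladder-121-mono zero {b = b} {b'} _ = ≤-reflexive (trans (vanishes b) (sym (vanishes b')))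
  where
  vanishes : ∀ b → binom (one ∷ twos b) [121] ≡ 0
  vanishes b = cong₂ _+_ (binom-twos-21 b) (binom-twos-one b _)
ladder-121-mono (suc m) {k} {k'} {b} {b'} k≤k' = begin
  binom (ladder k (suc m) b) [121]    ≡⟨ ladder-121-suc k m b ⟩
  binom (ladder k (suc m) b) [21] + binom (ladder (suc k) m b) [121]
    ≤⟨ +-mono-≤ (ladder-21-mono (suc m) k≤k') (ladder-121-mono m (s≤s k≤k')) ⟩
  binom (ladder k' (suc m) b') [21] + binom (ladder (suc k') m b') [121]
    ≡⟨ ladder-121-suc k' m b' ⟨
  binom (ladder k' (suc m) b') [121]  ∎
  where open ≤-Reasoning

ladder-121-strict : ∀ m {k k' b b'} → k < k' →
  binom (ladder k (suc m) b) [121] < binom (ladder k' (suc m) b') [121]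
ladder-121-strict m {k} {k'} {b} {b'} k<k' = begin-strict
  binom (ladder k (suc m) b) [121]    ≡⟨ ladder-121-suc k m b ⟩
  binom (ladder k (suc m) b) [21] + binom (ladder (suc k) m b) [121]
    <⟨ +-mono-<-≤ (ladder-21-strict m k<k') (ladder-121-mono m (s≤s (<⇒≤ k<k'))) ⟩
  binom (ladder k' (suc m) b') [21] + binom (ladder (suc k') m b') [121]
    ≡⟨ ladder-121-suc k' m b' ⟨
  binom (ladder k' (suc m) b') [121]  ∎
  where open ≤-Reasoning

ladder-121-injective : ∀ m {k k' b b'} →
  binom (ladder k (suc m) b) [121] ≡ binom (ladder k' (suc m) b') [121] → k ≡ k'
ladder-121-injective m {k} {k'} e with <-cmp k k'
... | tri< k<k' _ _ = ⊥-elim (<-irrefl e (ladder-121-strict m k<k'))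
... | tri≈ _ k≡k' _ = k≡k'
... | tri> _ _ k>k' = ⊥-elim (<-irrefl (sym e) (ladder-121-strict m k>k'))

ladder-21-independent-of-last-run : ∀ k m b b' → binom (ladder k m b) [21] ≡ binom (ladder k m b') [21]
ladder-21-independent-of-last-run k m b b' =
  ≤-antisym (ladder-21-mono m ≤-refl) (ladder-21-mono m ≤-refl)

ladder-length-injective : ∀ k m {b b'} → length (ladder k m b) ≡ length (ladder k m b') → b ≡ b'
ladder-length-injective k zero    {b} {b'} e =
  trans (sym (length-replicate b)) (trans (suc-injective e) (length-replicate b'))
ladder-length-injective k (suc m) e =
  ladder-length-injective (suc k) m (length-++-cancelˡ (twos k) (suc-injective e))

climb-21 : ∀ a k m b → binom (twos a ++ ladder k m b) [21] ≡ a * suc m + binom (ladder k m b) [21]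
climb-21 a k m b =
  trans (binom-twos-++-21 a _) (cong (λ o → a * o + binom (ladder k m b) [21]) (ladder-ones k m b))

climb-∼₃⇒first-run≡ : ∀ m {a a' k b b'} → (twos a ++ ladder k m b) ∼₃ (twos a' ++ ladder k m b') → a ≡ a'
climb-∼₃⇒first-run≡ m {a} {a'} {k} {b} {b'} u∼v =
  *-cancelʳ-≡ a a' (suc m) (+-cancelʳ-≡ (binom (ladder k m b) [21]) _ _ (begin
    a * suc m + binom (ladder k m b) [21]     ≡⟨ climb-21 a k m b ⟨
    binom (twos a ++ ladder k m b) [21]       ≡⟨ binom-∼₃ u∼v [21] ⟩
    binom (twos a' ++ ladder k m b') [21]     ≡⟨ climb-21 a' k m b' ⟩
    a' * suc m + binom (ladder k m b') [21]
      ≡⟨ cong (a' * suc m +_) (ladder-21-independent-of-last-run k m b' b) ⟩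
    a' * suc m + binom (ladder k m b) [21]    ∎))
  where open ≡-Reasoning

climb-∼₃-injective-same-start : ∀ m {a a' k b b'} →
  (twos a ++ ladder k m b) ∼₃ (twos a' ++ ladder k m b') →
  twos a ++ ladder k m b ≡ twos a' ++ ladder k m b'
climb-∼₃-injective-same-start m {a} {k = k} u∼v
  with refl ← climb-∼₃⇒first-run≡ m u∼v
  with refl ← ladder-length-injective k m (length-++-cancelˡ (twos a) (∼₃⇒length≡ u∼v)) = refl

climb-∼₃⇒start≡ : ∀ m {a a' k k' b b'} →
  (twos a ++ ladder k (suc m) b) ∼₃ (twos a' ++ ladder k' (suc m) b') → k ≡ k'
climb-∼₃⇒start≡ m {a} {a'} u∼v = ladder-121-injective m
  (trans (sym (binom-twos-++-one a _ _)) (trans (binom-∼₃ u∼v [121]) (binom-twos-++-one a' _ _)))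

climb-∼₃-injective : ∀ m {a a' k k' b b'} →
  (twos a ++ ladder k m b) ∼₃ (twos a' ++ ladder k' m b') →
  twos a ++ ladder k m b ≡ twos a' ++ ladder k' m b'
climb-∼₃-injective zero {a} {a'} {k} {b = b} {b'} u∼v =
  climb-∼₃-injective-same-start zero {a} {a'} {k} {b} {b'} u∼v
climb-∼₃-injective (suc m) u∼v with refl ← climb-∼₃⇒start≡ m u∼v =
  climb-∼₃-injective-same-start (suc m) u∼v

flat≁climb : ∀ n a k m b → ¬ (twos n ∼₃ (twos a ++ ladder k m b))
flat≁climb n a k m b u∼v =
  0≢1+n (trans (sym (binom-twos-one n [])) (trans (binom-∼₃ u∼v [1]) (climb-ones a k m b)))

Shape-∼₃-injective : ∀ {r j r' j' u v} → Shape r j u → Shape r' j' v → u ∼₃ v → u ≡ v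
Shape-∼₃-injective (flat n)    (flat n')     u∼v =
  cong twos (trans (sym (length-replicate n)) (trans (∼₃⇒length≡ u∼v) (length-replicate n')))
Shape-∼₃-injective {r' = r'} {j'} (flat n) (climb m b) u∼v = ⊥-elim (flat≁climb n r' j' m b u∼v)
Shape-∼₃-injective {r} {j} (climb m b) (flat n)         u∼v = ⊥-elim (flat≁climb n r j m b (∼₃-sym u∼v))
Shape-∼₃-injective {r} {j} {r'} {j'} (climb m b) (climb m' b') u∼v
  with refl ← suc-injective
    (trans (sym (climb-ones r j m b)) (trans (binom-∼₃ u∼v [1]) (climb-ones r' j' m' b')))
  = climb-∼₃-injective m u∼v

window-∼₃-injective : ∀ n s s' → window s n ∼₃ window s' n → window s n ≡ window s' n
window-∼₃-injective n (r , j) (r' , j') = Shape-∼₃-injective (window-shape n r j) (window-shape n r' j')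

window-zeros : ∀ n s → binom (window s n) [0] ≡ 0
window-zeros zero    s           = refl
window-zeros (suc n) (zero  , j) = window-zeros n (j , suc j)
window-zeros (suc n) (suc r , j) = window-zeros n (r , j)

prefix≁window : ∀ n i → ¬ (factorAt h 0 (suc n) ∼₃ factorAt h (suc i) (suc n))
prefix≁window n i u∼v = 1+n≢0 (begin
  binom (factorAt h 0 (suc n)) [0]                  ≡⟨ binom-∼₃ u∼v [0] ⟩
  binom (factorAt h (suc i) (suc n)) [0]            ≡⟨ cong (λ w → binom w [0]) (factorAt-h-suc i (suc n)) ⟩
  binom (window (step^ i start) (suc n)) [0]        ≡⟨ window-zeros (suc n) (step^ i start) ⟩
  0                                                 ∎)
  where open ≡-Reasoning

factor-∼₃-injective : ∀ n {u v} → IsFactor h n u → IsFactor h n v → u ∼₃ v → u ≡ v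
factor-∼₃-injective zero    (_ , refl)     (_ , refl)      _   = refl
factor-∼₃-injective (suc n) (zero , refl)  (zero , refl)   _   = refl
factor-∼₃-injective (suc n) (zero , refl)  (suc i' , refl) u∼v = ⊥-elim (prefix≁window n i' u∼v)
factor-∼₃-injective (suc n) (suc i , refl) (zero , refl)   u∼v = ⊥-elim (prefix≁window n i (∼₃-sym u∼v))
factor-∼₃-injective (suc n) (suc i , refl) (suc i' , refl) u∼v =
  trans e (trans (window-∼₃-injective (suc n) (step^ i start) (step^ i' start) (subst₂ _∼₃_ e e' u∼v))
                 (sym e'))
  where
  e : factorAt h (suc i) (suc n) ≡ window (step^ i start) (suc n)
  e  = factorAt-h-suc i (suc n)
  e' : factorAt h (suc i') (suc n) ≡ window (step^ i' start) (suc n)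
  e' = factorAt-h-suc i' (suc n)

proposition7p6 : ∀ (n : ℕ) → ∃[ k ] (FactorComplexityIs h n k × BinomialComplexity3Is h n k)
proposition7p6 n = complexities-agree h n (factors n) (∈-factors⇔ n) (factor-∼₃-injective n)
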